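{- Let $\mathsf{X}$ be a generalized quasi-variety and let $\kappa>0$ be a cardinal. If $\mathsf{Y}$ is a generalized quasi-variety such that $\mathsf{X}^{[\kappa]}\subseteq \mathsf{Y}$, then the map $[\kappa]\colon \mathsf{X}\to\mathsf{Y}$ given by $\mathbf{A}\mapsto \mathbf{A}^{[\kappa]}$ and $f\mapsto f^{[\kappa]}$ is a right adjoint functor.
   Context: A generalized quasi-equation is an expression $(\bigwedge_{i\in I}\alpha_i\approx\beta_i)\to\varphi\approx\psi$ with $I$ a possibly infinite set; a generalized quasi-variety is a class of algebras axiomatized by a set of generalized quasi-equations whose number of variables is bounded by some infinite cardinal. Generalized quasi-varieties are regarded as categories with homomorphisms as arrows; if the language has no constant symbols, the empty algebra is included as an object. Matrix power: for a class $\mathsf{X}$ of similar algebras with language $\mathscr{L}_{\mathsf{X}}$ and a cardinal $\kappa>0$, $\mathscr{L}^{\kappa}_{\mathsf{X}}$ is the language whose $n$-ary operation symbols (for each $n\in\omega$) are all $\kappa$-sequences $\langle t_i:i<\kappa\rangle$ of $\mathscr{L}_{\mathsf{X}}$-terms in the variables $\{x^j_m:1\le m\le n,\ j<\kappa\}$. For $\mathbf{A}\in\mathsf{X}$, $\mathbf{A}^{[\kappa]}$ is the $\mathscr{L}^{\kappa}_{\mathsf{X}}$-algebra with universe $A^{\kappa}$ in which $\langle t_i:i<\kappa\rangle(a_1,\dots,a_n)$ is the $\kappa$-sequence whose $i$-th entry is $t_i^{\mathbf{A}}$ evaluated by assigning $a_m(j)$ to $x^j_m$. For a homomorphism $f\colon\mathbf{A}\to\mathbf{B}$,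 $f^{[\kappa]}\langle a_i:i<\kappa\rangle=\langle f(a_i):i<\kappa\rangle$. $\mathsf{X}^{[\kappa]}$ is the class of all isomorphic copies of algebras $\mathbf{A}^{[\kappa]}$ with $\mathbf{A}\in\mathsf{X}$. -}

module Defs where

open import Level using (0ℓ)
open import Data.Nat using (ℕ)
open import Data.Fin using (Fin)
open import Data.Product using (Σ; Σ-syntax; _×_; _,_; proj₁; proj₂)
open import Relation.Binary.Bundles using (Setoid)

record Signature : Set₁ where
  field
    Op : ℕ → Set
open Signature public

data Term (σ : Signature) (V : Set) : Set where
  var : V → Term σ V
  op  : ∀ {n} → Op σ n → (Fin n → Term σ V) → Term σ V

-- Algebras (carrier is a setoid; the carrier may be empty, so the empty
-- algebra is an object whenever the language has no constants).

record Algebra (σ : Signature) : Set₁ where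
  field
    setoid : Setoid 0ℓ 0ℓ
  open Setoid setoid public
  field
    ⟦_⟧ₒ   : ∀ {n} → Op σ n → (Fin n → Carrier) → Carrier
    ⟦⟧-cong : ∀ {n} (f : Op σ n) {as bs : Fin n → Carrier} →
              (∀ i → as i ≈ bs i) → ⟦ f ⟧ₒ as ≈ ⟦ f ⟧ₒ bs
∣_∣ : ∀ {σ} → Algebra σ → Set
∣ A ∣ = Algebra.Carrier A

module _ {σ : Signature} (A : Algebra σ) where
  open Algebra A

  eval : ∀ {V} → Term σ V → (V → Carrier) → Carrier
  eval (var x)  ρ = ρ x
  eval (op f ts) ρ = ⟦ f ⟧ₒ (λ i → eval (ts i) ρ)

  eval-cong : ∀ {V} (t : Term σ V) {ρ ρ' : V → Carrier} →
              (∀ x → ρ x ≈ ρ' x) → eval t ρ ≈ eval t ρ'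
  eval-cong (var x)   e = e x
  eval-cong (op f ts) e = ⟦⟧-cong f (λ i → eval-cong (ts i) e)

record IsHom {σ : Signature} (A B : Algebra σ)
             (h : ∣ A ∣ → ∣ B ∣) : Set where
  private
    module A = Algebra A
    module B = Algebra B
  field
    h-cong : ∀ {a a'} → a A.≈ a' → h a B.≈ h a'
    h-op   : ∀ {n} (f : Op σ n) (as : Fin n → ∣ A ∣) →
             h (A.⟦ f ⟧ₒ as) B.≈ B.⟦ f ⟧ₒ (λ i → h (as i))

Hom : {σ : Signature} → Algebra σ → Algebra σ → Set
Hom A B = Σ (∣ A ∣ → ∣ B ∣) (IsHom A B)

-- A generalized quasi-equation
--   (⋀_{i ∈ I} αᵢ ≈ βᵢ) → φ ≈ ψ
-- has an arbitrary (possibly infinite) premise index set I.  All axioms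
-- of a given generalized quasi-variety use variables from one fixed set
-- Var (this is the bound on the number of variables).

record GQE (σ : Signature) (V : Set) : Set₁ where
  field
    I     : Set
    α β   : I → Term σ V
    φ ψ   : Term σ V

record GQV (σ : Signature) : Set₁ where
  field
    Var  : Set
    Ax   : Set
    axiom : Ax → GQE σ Var

_⊨ₑ_ : ∀ {σ V} → Algebra σ → GQE σ V → Set
A ⊨ₑ e = ∀ (ρ : _ → ∣ A ∣) →
           (∀ i → eval A (α i) ρ ≈ eval A (β i) ρ) → eval A φ ρ ≈ eval A ψ ρ
  where open GQE e
        open Algebra A using (_≈_)

_∈GQV_ : ∀ {σ} → Algebra σ → GQV σ → Set
A ∈GQV X = ∀ (a : GQV.Ax X) → A ⊨ₑ GQV.axiom X a

-- Matrix powers.  A cardinal κ > 0 is represented by a type K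
-- (together with an element of K).  The n-ary symbols of L^κ are
-- κ-sequences of L-terms in the variables x^j_m, m ∈ Fin n, j ∈ K.

_^ₛ_ : Signature → Set → Signature
Op (σ ^ₛ K) n = K → Term σ (Fin n × K)

_^[_] : ∀ {σ} → Algebra σ → (K : Set) → Algebra (σ ^ₛ K)
_^[_] {σ} A K = record
  { setoid = record
      { Carrier = K → Carrier
      ; _≈_ = λ a b → ∀ j → a j ≈ b j
      ; isEquivalence = record
          { refl = λ j → refl
          ; sym = λ e j → sym (e j)
          ; trans = λ e e' j → trans (e j) (e' j) } }
  ; ⟦_⟧ₒ = λ t as i → eval A (t i) (λ mj → as (proj₁ mj) (proj₂ mj))
  ; ⟦⟧-cong = λ t e i → eval-cong A (t i) (λ mj → e (proj₁ mj) (proj₂ mj))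
  }
  where open Algebra A

_^[_]ₕ : ∀ {σ} {A B : Algebra σ} → (∣ A ∣ → ∣ B ∣) → (K : Set) →
         (K → ∣ A ∣) → (K → ∣ B ∣)
(f ^[ K ]ₕ) a = λ i → f (a i)

-- The map [κ] : X → Y (A ↦ A^[κ], f ↦ f^[κ]) is a right adjoint
-- functor: it is a functor (sends homomorphisms to homomorphisms;
-- identities and composition are preserved definitionally) and every
-- object B of Y has a universal arrow η : B → A^[κ] into the functor
-- (Mac Lane, CWM IV.1 Thm 2), i.e. for every C ∈ X and homomorphism
-- h : B → C^[κ] there is a unique g : A → C with g^[κ] ∘ η = h.

record IsRightAdjoint {σ : Signature} (X : GQV σ) (K : Set)
                      (Y : GQV (σ ^ₛ K)) : Set₁ where
  field
    functor : ∀ (A C : Algebra σ) → A ∈GQV X → C ∈GQV X →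
              (f : Hom A C) →
              IsHom (A ^[ K ]) (C ^[ K ]) (_^[_]ₕ {A = A} {B = C} (proj₁ f) K)
    universal :
      ∀ (B : Algebra (σ ^ₛ K)) → B ∈GQV Y →
      Σ[ A ∈ Algebra σ ] A ∈GQV X ×
      Σ[ η ∈ Hom B (A ^[ K ]) ]
        (∀ (C : Algebra σ) → C ∈GQV X → (h : Hom B (C ^[ K ])) →
          Σ[ g ∈ Hom A C ]
            ((∀ b → Algebra._≈_ (C ^[ K ])
                      (_^[_]ₕ {A = A} {B = C} (proj₁ g) K (proj₁ η b))
                      (proj₁ h b))
            × (∀ (g' : Hom A C) →
                 (∀ b → Algebra._≈_ (C ^[ K ])
                          (_^[_]ₕ {A = A} {B = C} (proj₁ g') K (proj₁ η b))
                          (proj₁ h b)) →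
                 ∀ a → Algebra._≈_ C (proj₁ g' a) (proj₁ g a))))

{-# OPTIONS --safe #-}
-- For B in Y, the left adjoint sends B to the X-algebra presented by
-- generators bⱼ (b ∈ B, j ∈ κ) subject to the relations that copy the
-- equality and the operations of B coordinatewise:
--   (⟨tᵢ⟩(b₁,…,bₙ))ᵢ = tᵢ(x^j_m := (b_m)ⱼ).
-- Terms modulo the least congruence that contains these relations and is
-- closed under the generalized quasi-equations of X form an algebra of X,
-- and homomorphisms from it into C ∈ X are exactly assignments of the
-- generators respecting the relations, i.e. homomorphisms B → C^[κ].
module Submission where

open import Defs
open import Data.Fin using (Fin)
open import Data.Product using (_×_; _,_; proj₁; proj₂)

substitute : ∀ {σ V W} → Term σ V → (V → Term σ W) → Term σ W
substitute (var x)   ρ = ρ x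
substitute (op f ts) ρ = op f (λ i → substitute (ts i) ρ)

module _ {σ : Signature} (A : Algebra σ) where
  open Algebra A

  eval-substitute : ∀ {V W} (t : Term σ V) (ρ : V → Term σ W) (θ : W → Carrier) →
                    eval A (substitute t ρ) θ ≈ eval A t (λ x → eval A (ρ x) θ)
  eval-substitute (var x)   ρ θ = refl
  eval-substitute (op f ts) ρ θ = ⟦⟧-cong f (λ i → eval-substitute (ts i) ρ θ)

eval-hom : ∀ {σ} (A C : Algebra σ) (f : Hom A C) {V} (t : Term σ V) (ρ : V → ∣ A ∣) →
           Algebra._≈_ C (proj₁ f (eval A t ρ)) (eval C t (λ x → proj₁ f (ρ x)))
eval-hom A C f (var x)    ρ = Algebra.refl C
eval-hom A C f (op g ts) ρ =
  Algebra.trans C (IsHom.h-op (proj₂ f) g _)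
                  (Algebra.⟦⟧-cong C g (λ i → eval-hom A C f (ts i) ρ))

^[]-isHom : ∀ {σ} (A C : Algebra σ) (K : Set) (f : Hom A C) →
            IsHom (A ^[ K ]) (C ^[ K ]) (_^[_]ₕ {A = A} {B = C} (proj₁ f) K)
^[]-isHom A C K f = record
  { h-cong = λ e j → IsHom.h-cong (proj₂ f) (e j)
  ; h-op   = λ t as i → eval-hom A C f (t i) _
  }

module Presented {σ : Signature} (X : GQV σ) {G : Set}
                 (_~_ : Term σ G → Term σ G → Set) where

  infix 4 _≃_

  data _≃_ : Term σ G → Term σ G → Set where
    ≃-refl  : ∀ {t} → t ≃ t
    ≃-sym   : ∀ {t u} → t ≃ u → u ≃ t
    ≃-trans : ∀ {t u v} → t ≃ u → u ≃ v → t ≃ v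
    ≃-cong  : ∀ {n} (f : Op σ n) {ts us : Fin n → Term σ G} →
              (∀ i → ts i ≃ us i) → op f ts ≃ op f us
    ≃-rel   : ∀ {t u} → t ~ u → t ≃ u
    ≃-axiom : (a : GQV.Ax X) (ρ : GQV.Var X → Term σ G) →
              let open GQE (GQV.axiom X a) in
              (∀ i → substitute (α i) ρ ≃ substitute (β i) ρ) →
              substitute φ ρ ≃ substitute ψ ρ

  algebra : Algebra σ
  algebra = record
    { setoid  = record
        { Carrier       = Term σ G
        ; _≈_           = _≃_
        ; isEquivalence = record { refl = ≃-refl ; sym = ≃-sym ; trans = ≃-trans }
        }
    ; ⟦_⟧ₒ    = op
    ; ⟦⟧-cong = ≃-cong
    }

  eval-algebra : ∀ {V} (t : Term σ V) (ρ : V → Term σ G) →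
                 eval algebra t ρ ≃ substitute t ρ
  eval-algebra (var x)   ρ = ≃-refl
  eval-algebra (op f ts) ρ = ≃-cong f (λ i → eval-algebra (ts i) ρ)

  algebra∈GQV : algebra ∈GQV X
  algebra∈GQV a ρ premises =
    ≃-trans (eval-algebra φ ρ)
      (≃-trans (≃-axiom a ρ (λ i → ≃-trans (≃-sym (eval-algebra (α i) ρ))
                                   (≃-trans (premises i) (eval-algebra (β i) ρ))))
               (≃-sym (eval-algebra ψ ρ)))
    where open GQE (GQV.axiom X a)

  module _ (C : Algebra σ) where
    open Algebra C

    lift-unique : (g : Hom algebra C) (ρ : G → Carrier) →
                  (∀ x → proj₁ g (var x) ≈ ρ x) →
                  ∀ t → proj₁ g t ≈ eval C t ρ
    lift-unique g ρ g-var (var x)   = g-var x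
    lift-unique g ρ g-var (op f ts) =
      trans (IsHom.h-op (proj₂ g) f ts) (⟦⟧-cong f (λ i → lift-unique g ρ g-var (ts i)))

    module _ (C∈X : C ∈GQV X) (ρ : G → Carrier)
             (respects : ∀ {t u} → t ~ u → eval C t ρ ≈ eval C u ρ) where

      private
        eval-subst : ∀ {V} (t : Term σ V) (θ : V → Term σ G) →
                     eval C (substitute t θ) ρ ≈ eval C t (λ x → eval C (θ x) ρ)
        eval-subst t θ = eval-substitute C t θ ρ

      lift-cong : ∀ {t u} → t ≃ u → eval C t ρ ≈ eval C u ρ
      lift-cong ≃-refl           = refl
      lift-cong (≃-sym e)        = sym (lift-cong e)
      lift-cong (≃-trans e e')   = trans (lift-cong e) (lift-cong e')
      lift-cong (≃-cong f es)    = ⟦⟧-cong f (λ i → lift-cong (es i))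
      lift-cong (≃-rel r)        = respects r
      lift-cong (≃-axiom a θ es) =
        trans (eval-subst φ θ)
          (trans (C∈X a (λ x → eval C (θ x) ρ)
                   (λ i → trans (sym (eval-subst (α i) θ))
                                (trans (lift-cong (es i)) (eval-subst (β i) θ))))
                 (sym (eval-subst ψ θ)))
        where open GQE (GQV.axiom X a)

      lift : Hom algebra C
      lift = (λ t → eval C t ρ) , record { h-cong = lift-cong ; h-op = λ f ts → refl }

module LeftAdjoint {σ : Signature} {K : Set} (X : GQV σ) (B : Algebra (σ ^ₛ K)) where
  open Algebra B

  Generator : Set
  Generator = Carrier × K

  coordinates : ∀ {n} → (Fin n → Carrier) → Fin n × K → Term σ Generator
  coordinates bs (m , j) = var (bs m , j)

  data _~_ : Term σ Generator → Term σ Generator → Set where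
    coordinate-cong : ∀ {b b'} (j : K) → b ≈ b' → var (b , j) ~ var (b' , j)
    coordinate-op   : ∀ {n} (f : Op (σ ^ₛ K) n) (bs : Fin n → Carrier) (i : K) →
                      var (⟦ f ⟧ₒ bs , i) ~ substitute (f i) (coordinates bs)

  open Presented X _~_ public

  unit : Hom B (algebra ^[ K ])
  unit = (λ b j → var (b , j)) , record
    { h-cong = λ e j → ≃-rel (coordinate-cong j e)
    ; h-op   = λ f bs i → ≃-trans (≃-rel (coordinate-op f bs i))
                                  (≃-sym (eval-algebra (f i) (coordinates bs)))
    }

  module _ (C : Algebra σ) (h : Hom B (C ^[ K ])) where
    module C = Algebra C

    transpose : Generator → C.Carrier
    transpose (b , j) = proj₁ h b j

    transpose-respects : ∀ {t u} → t ~ u → eval C t transpose C.≈ eval C u transpose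
    transpose-respects (coordinate-cong j e) = IsHom.h-cong (proj₂ h) e j
    transpose-respects (coordinate-op f bs i) =
      C.trans (IsHom.h-op (proj₂ h) f bs i)
              (C.sym (eval-substitute C (f i) (coordinates bs) transpose))

theorem2p5 : (σ : Signature) (X : GQV σ) (K : Set) → K →
             (Y : GQV (σ ^ₛ K)) →
             (∀ (A : Algebra σ) → A ∈GQV X → (A ^[ K ]) ∈GQV Y) →
             IsRightAdjoint X K Y
theorem2p5 σ X K _ Y _ = record
  { functor   = λ A C _ _ → ^[]-isHom A C K
  ; universal = λ B _ → let open LeftAdjoint X B in
      algebra , algebra∈GQV , unit , λ C C∈X h →
        lift C C∈X (transpose C h) (transpose-respects C h) ,
        (λ b j → Algebra.refl C) ,
        λ g' g'∘unit≈h → lift-unique C g' (transpose C h) (λ (b , j) → g'∘unit≈h b j)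
  }
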